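{- Let $\mathcal{C}$ be a class of $\{0,1\}$-valued functions over a domain $X$, let $f_1,\dots,f_k\in\mathcal{C}$ and $f=f_1\wedge\dots\wedge f_k$. Then for each $i=1,\dots,k$, $$ S_0(f_i,\mathcal{C})\cap\bigcap_{j\neq i}M_1(f_j)\subseteq S_0(f,\mathcal{C}^k). $$
   Context: $M_\nu(f)=\{x\in X: f(x)=\nu\}$. $\mathcal{C}^k$ is the class of functions that can be written as a conjunction of $k$ functions from $\mathcal{C}$. For a class $\mathcal{D}$ and $g\in\mathcal{D}$, a point $x\in X$ is essential for $g$ with respect to $\mathcal{D}$ if there is $h\in\mathcal{D}$ with $h(x)\neq g(x)$ and $h=g$ on $X\setminus\{x\}$; $S(g,\mathcal{D})$ is the set of essential points and $S_\nu(g,\mathcal{D})=S(g,\mathcal{D})\cap M_\nu(g)$. -}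

module Defs where

open import Level using (Level; _⊔_; suc)
open import Data.Bool using (Bool; true; false; _∧_)
open import Data.Nat using (ℕ)
open import Data.Fin using (Fin)
open import Data.Product using (Σ; _×_; ∃)
open import Relation.Binary.PropositionalEquality using (_≡_; _≢_)

Class : ∀ {a} (X : Set a) → Set (suc a)
Class {a} X = (X → Bool) → Set a

M : ∀ {a} {X : Set a} → Bool → (X → Bool) → X → Set
M ν f x = f x ≡ ν

⋀ : ∀ {a} {X : Set a} {k : ℕ} → (Fin k → X → Bool) → X → Bool
⋀ {k = ℕ.zero} fs x = true
⋀ {k = ℕ.suc k} fs x = fs Fin.zero x ∧ ⋀ (λ i → fs (Fin.suc i)) x

-- C^k: functions equal (pointwise) to a conjunction of k members of C.
Conj : ∀ {a} {X : Set a} → ℕ → Class X → Class X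
Conj k C h = Σ (Fin k → _ ) λ gs → ((i : Fin k) → C (gs i)) × (∀ x → h x ≡ ⋀ gs x)

Essential : ∀ {a} {X : Set a} → Class X → (X → Bool) → X → Set a
Essential D g x =
  Σ _ λ h → D h × (h x ≢ g x) × (∀ y → y ≢ x → h y ≡ g y)

S : ∀ {a} {X : Set a} → Bool → (X → Bool) → Class X → X → Set a
S ν g D x = Essential D g x × M ν g x

module Submission where

-- Let h ∈ C differ from fᵢ exactly at x.  Since fᵢ x = 0, h x = 1.
-- Replacing the i-th conjunct by h gives a family g of k members of C whose
-- conjunction ⋀ g lies in Cᵏ.  Off x every gⱼ agrees with fⱼ, so ⋀ g agrees
-- with f; at x every gⱼ is 1, so ⋀ g x = 1 ≠ 0 = f x.  Hence ⋀ g witnesses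
-- that x is essential for f, and f x = 0 because one conjunct vanishes there.

open import Defs
open import Data.Bool using (Bool; true; false; _∧_)
open import Data.Bool.Properties using (∧-zeroʳ; ¬-not)
open import Data.Nat using (ℕ; zero; suc)
open import Data.Fin using (Fin; zero; suc; _≟_)
open import Data.Vec.Functional using (updateAt)
open import Data.Vec.Functional.Properties using (updateAt-updates; updateAt-minimal)
open import Data.Product using (_×_; _,_)
open import Function using (const)
open import Relation.Binary.PropositionalEquality
  using (_≡_; _≢_; refl; sym; trans; cong; cong₂; subst)
open import Relation.Nullary using (yes; no)

module _ {a} {X : Set a} where

  ⋀-false : ∀ {k} (fs : Fin k → X → Bool) (i : Fin k) (x : X)
    → fs i x ≡ false → ⋀ fs x ≡ false
  ⋀-false fs zero    x fᵢx≡0 = cong (_∧ ⋀ (λ j → fs (suc j)) x) fᵢx≡0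
  ⋀-false fs (suc i) x fᵢx≡0 =
    trans (cong (fs zero x ∧_) (⋀-false (λ j → fs (suc j)) i x fᵢx≡0)) (∧-zeroʳ _)

  ⋀-true : ∀ {k} (fs : Fin k → X → Bool) (x : X)
    → (∀ j → fs j x ≡ true) → ⋀ fs x ≡ true
  ⋀-true {zero}  fs x all≡1 = refl
  ⋀-true {suc k} fs x all≡1 =
    cong₂ _∧_ (all≡1 zero) (⋀-true (λ j → fs (suc j)) x (λ j → all≡1 (suc j)))

  ⋀-cong : ∀ {k} (fs gs : Fin k → X → Bool) (y : X)
    → (∀ j → fs j y ≡ gs j y) → ⋀ fs y ≡ ⋀ gs y
  ⋀-cong {zero}  fs gs y agree = refl
  ⋀-cong {suc k} fs gs y agree =
    cong₂ _∧_ (agree zero)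
      (⋀-cong (λ j → fs (suc j)) (λ j → gs (suc j)) y (λ j → agree (suc j)))

  replace : ∀ {k} → (Fin k → X → Bool) → Fin k → (X → Bool) → Fin k → X → Bool
  replace fs i h = updateAt fs i (const h)

  replace-∈ : ∀ {k} (C : Class X) (fs : Fin k → X → Bool) (i : Fin k) (h : X → Bool)
    → (∀ j → C (fs j)) → C h → ∀ j → C (replace fs i h j)
  replace-∈ C fs i h fs∈C h∈C j with j ≟ i
  ... | yes refl = subst C (sym (updateAt-updates i fs)) h∈C
  ... | no j≢i   = subst C (sym (updateAt-minimal j i fs j≢i)) (fs∈C j)

  replace-agrees : ∀ {k} (fs : Fin k → X → Bool) (i : Fin k) (h : X → Bool) (y : X)
    → h y ≡ fs i y → ∀ j → replace fs i h j y ≡ fs j y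
  replace-agrees fs i h y hy≡fᵢy j with j ≟ i
  ... | yes refl = trans (cong (λ g → g y) (updateAt-updates i fs)) hy≡fᵢy
  ... | no j≢i   = cong (λ g → g y) (updateAt-minimal j i fs j≢i)

  replace-true : ∀ {k} (fs : Fin k → X → Bool) (i : Fin k) (h : X → Bool) (x : X)
    → h x ≡ true → (∀ j → j ≢ i → fs j x ≡ true) → ∀ j → replace fs i h j x ≡ true
  replace-true fs i h x hx≡1 others≡1 j with j ≟ i
  ... | yes refl = trans (cong (λ g → g x) (updateAt-updates i fs)) hx≡1
  ... | no j≢i   = trans (cong (λ g → g x) (updateAt-minimal j i fs j≢i)) (others≡1 j j≢i)

  replace-differs-exactly-at : ∀ {k} (fs : Fin k → X → Bool) (i : Fin k) (h : X → Bool) (x : X)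
    → fs i x ≡ false → h x ≢ fs i x → (∀ y → y ≢ x → h y ≡ fs i y)
    → (∀ j → j ≢ i → fs j x ≡ true)
    → ⋀ (replace fs i h) x ≢ ⋀ fs x × (∀ y → y ≢ x → ⋀ (replace fs i h) y ≡ ⋀ fs y)
  replace-differs-exactly-at fs i h x fᵢx≡0 hx≢fᵢx agree others≡1 =
    differs-at-x , agrees-off-x
    where
      hx≡1 : h x ≡ true
      hx≡1 = ¬-not (λ hx≡0 → hx≢fᵢx (trans hx≡0 (sym fᵢx≡0)))

      differs-at-x : ⋀ (replace fs i h) x ≢ ⋀ fs x
      differs-at-x eq with trans (sym (⋀-true (replace fs i h) x (replace-true fs i h x hx≡1 others≡1)))
                                 (trans eq (⋀-false fs i x fᵢx≡0))
      ... | ()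

      agrees-off-x : ∀ y → y ≢ x → ⋀ (replace fs i h) y ≡ ⋀ fs y
      agrees-off-x y y≢x = ⋀-cong (replace fs i h) fs y (replace-agrees fs i h y (agree y y≢x))

proposition2 : ∀ {a} (X : Set a) (C : Class X) (k : ℕ) (fs : Fin k → X → Bool)
    → ((i : Fin k) → C (fs i))
    → (i : Fin k) (x : X)
    → S false (fs i) C x
    → ((j : Fin k) → j ≢ i → M true (fs j) x)
    → S false (⋀ fs) (Conj k C) x
proposition2 X C k fs fs∈C i x ((h , h∈C , hx≢fᵢx , agree) , fᵢx≡0) others≡1 =
  (⋀ g , g∈Cᵏ , replace-differs-exactly-at fs i h x fᵢx≡0 hx≢fᵢx agree others≡1) ,
  ⋀-false fs i x fᵢx≡0
  where
    g : Fin k → X → Bool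
    g = replace fs i h

    g∈Cᵏ : Conj k C (⋀ g)
    g∈Cᵏ = g , replace-∈ C fs i h fs∈C h∈C , λ _ → refl
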